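{- Let $W_1$ be the graph with vertex set $\{x_1,x_2,x_3,x_4,x_5,x,y\}$ and edge set $\{x_1x_2,\ x_2x_3,\ x_3x_4,\ x_4x_5,\ yx_3,\ xx_2,\ xx_3,\ xx_4\}$. Then $W_1$ is a co-TT graph.
   Context: A graph $G=(V,E)$ is a threshold tolerance graph if each vertex $v$ can be assigned a positive weight $w_v$ and a positive tolerance $t_v$ such that for distinct $u,v$, $uv\in E$ iff $w_u+w_v>\min\{t_u,t_v\}$. A co-TT graph is the complement of a threshold tolerance graph. Equivalently (Monma–Reed–Trotter), $G$ is co-TT iff one can assign positive numbers $a_v,b_v$ to each vertex $v$ such that for distinct $x,y$: $xy\in E$ iff $a_x\le b_y$ and $a_y\le b_x$. -}

module Defs where

open import Data.Nat using (ℕ)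
open import Data.Fin using (Fin; zero; suc)
open import Data.Rational using (ℚ; _≤_; _<_; 0ℚ)
open import Data.Product using (_×_; Σ; _,_)
open import Data.Empty using (⊥)
open import Data.Unit using (⊤)
open import Function.Bundles using (_⇔_)
open import Relation.Binary.PropositionalEquality using (_≢_)

-- A finite simple graph on vertex set Fin n, given by its adjacency relation
-- (assumed symmetric and irreflexive; checked for W₁ below).
record Graph (n : ℕ) : Set₁ where
  field
    Adj : Fin n → Fin n → Set

open Graph public

-- Monma–Reed–Trotter characterization (the paper's working definition):
-- G is co-TT iff there are positive numbers a_v, b_v such that for distinct
-- x, y : xy ∈ E  iff  a_x ≤ b_y and a_y ≤ b_x.
IsCoTT : ∀ {n} → Graph n → Set
IsCoTT {n} G =
  Σ (Fin n → ℚ) λ a → Σ (Fin n → ℚ) λ b →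
    ((v : Fin n) → (0ℚ < a v) × (0ℚ < b v)) ×
    ((x y : Fin n) → x ≢ y →
       (Adj G x y ⇔ ((a x ≤ b y) × (a y ≤ b x))))

x₁ x₂ x₃ x₄ x₅ vx vy : Fin 7
x₁ = zero
x₂ = suc zero
x₃ = suc (suc zero)
x₄ = suc (suc (suc zero))
x₅ = suc (suc (suc (suc zero)))
vx = suc (suc (suc (suc (suc zero))))
vy = suc (suc (suc (suc (suc (suc zero)))))

E₁ : Fin 7 → Fin 7 → Set
E₁ zero (suc zero) = ⊤                                   -- x₁x₂
E₁ (suc zero) (suc (suc zero)) = ⊤                       -- x₂x₃
E₁ (suc (suc zero)) (suc (suc (suc zero))) = ⊤           -- x₃x₄
E₁ (suc (suc (suc zero))) (suc (suc (suc (suc zero)))) = ⊤  -- x₄x₅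
E₁ (suc (suc (suc (suc (suc (suc zero)))))) (suc (suc zero)) = ⊤  -- y x₃
E₁ (suc (suc (suc (suc (suc zero))))) (suc zero) = ⊤             -- x x₂
E₁ (suc (suc (suc (suc (suc zero))))) (suc (suc zero)) = ⊤       -- x x₃
E₁ (suc (suc (suc (suc (suc zero))))) (suc (suc (suc zero))) = ⊤ -- x x₄
E₁ _ _ = ⊥

open import Data.Sum using (_⊎_)

W₁ : Graph 7
W₁ = record { Adj = λ u v → E₁ u v ⊎ E₁ v u }

module Submission where

open import Defs
open import Agda.Builtin.FromNat using (Number; fromNat)
open import Data.Fin using (Fin; suc; _≟_)
open import Data.Fin.Patterns using (0F; 1F; 2F; 3F; 4F; 5F; 6F)
open import Data.Fin.Properties using (all?)
open import Data.Nat using (ℕ)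
import Data.Nat.Literals as ℕ
open import Data.Product using (_×_; _,_; uncurry)
open import Data.Rational using (ℚ; _≤_; _<_; 0ℚ)
import Data.Rational.Literals as ℚ
open import Data.Rational.Properties using (_≤?_; _<?_)
open import Data.Unit using (tt)
open import Function.Bundles using (_⇔_; mk⇔; Equivalence)
open import Relation.Binary.PropositionalEquality using (_≢_)
open import Relation.Nullary using (Dec; yes; no; ¬?)
open import Relation.Nullary.Decidable using (_×-dec_; _⊎-dec_; _→-dec_; map′; toWitness)

instance
  ℕ-number : Number ℕ
  ℕ-number = ℕ.number

  ℚ-number : Number ℚ
  ℚ-number = ℚ.number

_⇔-dec_ : ∀ {a b} {A : Set a} {B : Set b} → Dec A → Dec B → Dec (A ⇔ B)
a? ⇔-dec b? =
  map′ (uncurry mk⇔) (λ A⇔B → Equivalence.to A⇔B , Equivalence.from A⇔B)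
       ((a? →-dec b?) ×-dec (b? →-dec a?))

module _ {n : ℕ} where

  IsCoTTRepresentation : Graph n → (a b : Fin n → ℚ) → Set
  IsCoTTRepresentation G a b =
    ((v : Fin n) → (0ℚ < a v) × (0ℚ < b v)) ×
    ((x y : Fin n) → x ≢ y → (Adj G x y ⇔ ((a x ≤ b y) × (a y ≤ b x))))

  isCoTTRepresentation? : (G : Graph n) → ((x y : Fin n) → Dec (Adj G x y)) →
                          (a b : Fin n → ℚ) → Dec (IsCoTTRepresentation G a b)
  isCoTTRepresentation? G adj? a b =
    all? (λ v → (0ℚ <? a v) ×-dec (0ℚ <? b v)) ×-dec
    all? (λ x → all? (λ y →
      ¬? (x ≟ y) →-dec (adj? x y ⇔-dec ((a x ≤? b y) ×-dec (a y ≤? b x)))))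

-- The patterns follow the case tree of E₁, so that E₁ x y reduces to ⊥ in every `no` clause.
E₁? : (x y : Fin 7) → Dec (E₁ x y)
E₁? 0F 1F = yes tt
E₁? 0F 0F = no λ ()
E₁? 0F (suc (suc _)) = no λ ()
E₁? 1F 2F = yes tt
E₁? 1F 0F = no λ ()
E₁? 1F 1F = no λ ()
E₁? 1F (suc (suc (suc _))) = no λ ()
E₁? 2F 3F = yes tt
E₁? 2F 0F = no λ ()
E₁? 2F 1F = no λ ()
E₁? 2F 2F = no λ ()
E₁? 2F (suc (suc (suc (suc _)))) = no λ ()
E₁? 3F 4F = yes tt
E₁? 3F 0F = no λ ()
E₁? 3F 1F = no λ ()
E₁? 3F 2F = no λ ()
E₁? 3F 3F = no λ ()
E₁? 3F (suc (suc (suc (suc (suc _))))) = no λ ()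
E₁? 4F _ = no λ ()
E₁? 5F 1F = yes tt
E₁? 5F 2F = yes tt
E₁? 5F 3F = yes tt
E₁? 5F 0F = no λ ()
E₁? 5F (suc (suc (suc (suc _)))) = no λ ()
E₁? 6F 2F = yes tt
E₁? 6F 0F = no λ ()
E₁? 6F 1F = no λ ()
E₁? 6F (suc (suc (suc _))) = no λ ()

Adj-W₁? : (x y : Fin 7) → Dec (Adj W₁ x y)
Adj-W₁? x y = E₁? x y ⊎-dec E₁? y x

-- Found by exhaustive search; there is no integer representation with all values at most 4.
a b : Fin 7 → ℚ
a 0F = 1
a 1F = 1
a 2F = 2
a 3F = 3
a 4F = 5
a 5F = 2
a 6F = 4
b 0F = 1
b 1F = 2
b 2F = 4
b 3F = 5
b 4F = 3
b 5F = 3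
b 6F = 2

lemma12 : IsCoTT W₁
lemma12 = a , b , toWitness {a? = isCoTTRepresentation? W₁ Adj-W₁? a b} tt
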